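{- If $f(x,y)$ is an alternating invariant function and $m,n$ are positive odd integers, then for all $x\in\mathbb{R}$, $y>0$, $$\sum_{r=0}^{n-1}(-1)^r f(x+rmy,ny)=\sum_{r=0}^{m-1}(-1)^r f(x+rny,my).$$
   Context: A real function $f(x,y)$ defined for $x\in\mathbb{R}$, $y>0$ is called an alternating invariant function if $\sum_{r=0}^{n-1}(-1)^r f(x+ry,ny)=f(x,y)$ for every $x\in\mathbb{R}$, $y>0$ and every positive odd integer $n$. -}

module Defs where

open import Level using (0ℓ)
open import Data.Nat using (ℕ; zero; suc)
import Data.Nat as ℕ
open import Data.Product using (Σ; ∃; _×_; _,_)
open import Data.Sum using (_⊎_)
open import Relation.Binary.PropositionalEquality using (_≡_; _≢_)
open import Relation.Nullary using (¬_)

-- The real numbers, axiomatised (as usual) as a complete ordered field.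
-- (agda-stdlib has no real numbers.)  Any two models are isomorphic, so
-- quantifying over a model is the same as speaking about ℝ.
record RealNumbers : Set₁ where
  infixl 6 _+_
  infixl 7 _*_
  infix  8 -_
  infix  4 _<_ _≤_
  field
    ℝ   : Set
    0ℝ  : ℝ
    1ℝ  : ℝ
    _+_ : ℝ → ℝ → ℝ
    _*_ : ℝ → ℝ → ℝ
    -_  : ℝ → ℝ
    _⁻¹ : (x : ℝ) → x ≢ 0ℝ → ℝ
    _<_ : ℝ → ℝ → Set
    +-assoc     : ∀ x y z → (x + y) + z ≡ x + (y + z)
    +-comm      : ∀ x y → x + y ≡ y + x
    +-identityˡ : ∀ x → 0ℝ + x ≡ x
    -‿inverseˡ  : ∀ x → (- x) + x ≡ 0ℝ
    *-assoc     : ∀ x y z → (x * y) * z ≡ x * (y * z)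
    *-comm      : ∀ x y → x * y ≡ y * x
    *-identityˡ : ∀ x → 1ℝ * x ≡ x
    ⁻¹-inverseˡ : ∀ x (p : x ≢ 0ℝ) → (x ⁻¹) p * x ≡ 1ℝ
    distribˡ    : ∀ x y z → x * (y + z) ≡ x * y + x * z
    0≢1         : 0ℝ ≢ 1ℝ
    <-irrefl    : ∀ x → ¬ (x < x)
    <-trans     : ∀ x y z → x < y → y < z → x < z
    <-trichot   : ∀ x y → x < y ⊎ (x ≡ y ⊎ y < x)
    +-mono-<    : ∀ x y z → x < y → x + z < y + z
    *-pos       : ∀ x y → 0ℝ < x → 0ℝ < y → 0ℝ < x * y
  _≤_ : ℝ → ℝ → Set
  x ≤ y = x < y ⊎ x ≡ y
  field
    completeness : (S : ℝ → Set) → (∃ λ x → S x) → (∃ λ b → ∀ x → S x → x ≤ b) →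
                   ∃ λ s → (∀ x → S x → x ≤ s) × (∀ b → (∀ x → S x → x ≤ b) → s ≤ b)

module Reals (R : RealNumbers) where
  open RealNumbers R public

  fromℕ : ℕ → ℝ
  fromℕ zero    = 0ℝ
  fromℕ (suc n) = fromℕ n + 1ℝ

  sign : ℕ → ℝ
  sign zero    = 1ℝ
  sign (suc r) = - sign r

  altSum : ℕ → (ℕ → ℝ) → ℝ
  altSum zero    g = 0ℝ
  altSum (suc n) g = altSum n g + sign n * g n

  Odd : ℕ → Set
  Odd n = ∃ λ k → n ≡ suc (2 ℕ.* k)

  AlternatingInvariant : (ℝ → ℝ → ℝ) → Set
  AlternatingInvariant f =
    ∀ (x y : ℝ) → 0ℝ < y → ∀ (n : ℕ) → Odd n →
      altSum n (λ r → f (x + fromℕ r * y) (fromℕ n * y)) ≡ f x y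

{-# OPTIONS --safe #-}

-- Expanding each term f (x + r m y) (n y) on the left by invariance with m terms
-- turns the left side into the double alternating sum of f (x + (r m + s n) y) (m n y)
-- over r < n and s < m.  That sum is unchanged when m, n and r, s are exchanged,
-- so collapsing it over r instead, by invariance with n terms, gives the right side.
module Submission where

open import Defs
open import Data.Nat as ℕ using (ℕ; zero; suc)
open import Level using (0ℓ)
open import Data.Empty using (⊥-elim)
open import Data.Fin as Fin using (toℕ; inject₁)
open import Data.Fin.Properties using (toℕ-inject₁; toℕ-fromℕ)
open import Data.Product using (_,_)
open import Data.Sum using (inj₁; inj₂)
open import Function using (_∘_)
open import Algebra.Bundles using (CommutativeRing)
open import Algebra.Structures using (IsCommutativeRing)
open import Algebra.Consequences.Propositional
  using (comm∧idˡ⇒id; comm∧invˡ⇒inv; comm∧distrˡ⇒distrʳ)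
open import Relation.Binary.PropositionalEquality
  using (_≡_; refl; sym; trans; cong; cong₂; subst; subst₂; isEquivalence; module ≡-Reasoning)
import Algebra.Properties.Ring as RingProperties
import Algebra.Properties.CommutativeSemigroup as CommutativeSemigroupProperties
import Algebra.Properties.CommutativeMonoid.Sum as Sum
import Algebra.Properties.Semiring.Sum as SemiringSum

module Properties (R : RealNumbers) where
  open Reals R
  open ≡-Reasoning

  +-*-isCommutativeRing : IsCommutativeRing _≡_ _+_ _*_ -_ 0ℝ 1ℝ
  +-*-isCommutativeRing = record
    { isRing = record
      { +-isAbelianGroup = record
        { isGroup = record
          { isMonoid = record
            { isSemigroup = record
              { isMagma = record { isEquivalence = isEquivalence ; ∙-cong = cong₂ _+_ }
              ; assoc   = +-assoc
              }
            ; identity = comm∧idˡ⇒id +-comm +-identityˡ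
            }
          ; inverse = comm∧invˡ⇒inv +-comm -‿inverseˡ
          ; ⁻¹-cong = cong -_
          }
        ; comm = +-comm
        }
      ; *-cong     = cong₂ _*_
      ; *-assoc    = *-assoc
      ; *-identity = comm∧idˡ⇒id *-comm *-identityˡ
      ; distrib    = distribˡ , comm∧distrˡ⇒distrʳ *-comm distribˡ
      }
    ; *-comm = *-comm
    }

  +-*-commutativeRing : CommutativeRing 0ℓ 0ℓ
  +-*-commutativeRing = record { isCommutativeRing = +-*-isCommutativeRing }

  open CommutativeRing +-*-commutativeRing
    using ( ring; semiring; -‿inverseʳ
          ; +-commutativeSemigroup; +-commutativeMonoid; *-commutativeSemigroup)
  open RingProperties ring using (-1*x≈-x; -‿involutive)
  open CommutativeSemigroupProperties +-commutativeSemigroup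
    using () renaming (xy∙z≈xz∙y to x+y+z≡x+z+y)
  open CommutativeSemigroupProperties *-commutativeSemigroup public
    using () renaming (x∙yz≈y∙xz to x*[y*z]≡y*[x*z])
  open Sum +-commutativeMonoid using (sum-syntax; sum-cong-≗; sum-init-last; ∑-comm)
  open SemiringSum semiring using (*-distribˡ-sum)

  x<0⇒0<-x : ∀ {x} → x < 0ℝ → 0ℝ < - x
  x<0⇒0<-x {x} x<0 = subst₂ _<_ (-‿inverseʳ x) (+-identityˡ (- x)) (+-mono-< x 0ℝ (- x) x<0)

  -1*-1≡1 : - 1ℝ * - 1ℝ ≡ 1ℝ
  -1*-1≡1 = trans (-1*x≈-x (- 1ℝ)) (-‿involutive 1ℝ)

  0<1 : 0ℝ < 1ℝ
  0<1 with <-trichot 0ℝ 1ℝ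
  ... | inj₁ 0<1        = 0<1
  ... | inj₂ (inj₁ 0≡1) = ⊥-elim (0≢1 0≡1)
  ... | inj₂ (inj₂ 1<0) = ⊥-elim (<-irrefl 1ℝ (<-trans 1ℝ 0ℝ 1ℝ 1<0 0<-1*-1))
    where
    0<-1*-1 : 0ℝ < 1ℝ
    0<-1*-1 = subst (0ℝ <_) -1*-1≡1 (*-pos _ _ (x<0⇒0<-x 1<0) (x<0⇒0<-x 1<0))

  x<x+1 : ∀ x → x < x + 1ℝ
  x<x+1 x = subst₂ _<_ (+-identityˡ x) (+-comm 1ℝ x) (+-mono-< 0ℝ 1ℝ x 0<1)

  0<fromℕ-suc : ∀ k → 0ℝ < fromℕ (suc k)
  0<fromℕ-suc zero    = x<x+1 0ℝ
  0<fromℕ-suc (suc k) = <-trans _ _ _ (0<fromℕ-suc k) (x<x+1 _)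

  0<fromℕ-odd : ∀ {n} → Odd n → 0ℝ < fromℕ n
  0<fromℕ-odd (k , refl) = 0<fromℕ-suc (2 ℕ.* k)

  altSum-cong : ∀ n {g h : ℕ → ℝ} → (∀ r → g r ≡ h r) → altSum n g ≡ altSum n h
  altSum-cong zero    g≗h = refl
  altSum-cong (suc n) g≗h = cong₂ _+_ (altSum-cong n g≗h) (cong (sign n *_) (g≗h n))

  altSum≡∑ : ∀ n g → altSum n g ≡ ∑[ i < n ] (sign (toℕ i) * g (toℕ i))
  altSum≡∑ zero    g = refl
  altSum≡∑ (suc n) g = begin
    altSum n g + term n
      ≡⟨ cong₂ _+_ (altSum≡∑ n g) (cong term (sym (toℕ-fromℕ n))) ⟩
    ∑[ i < n ] term (toℕ i) + term (toℕ (Fin.fromℕ n))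
      ≡⟨ cong (_+ term (toℕ (Fin.fromℕ n))) (sum-cong-≗ {n} (cong term ∘ sym ∘ toℕ-inject₁)) ⟩
    ∑[ i < n ] term (toℕ (inject₁ i)) + term (toℕ (Fin.fromℕ n))
      ≡⟨ sym (sum-init-last (term ∘ toℕ)) ⟩
    ∑[ i < suc n ] term (toℕ i) ∎
    where
    term : ℕ → ℝ
    term r = sign r * g r

  altSum²≡∑∑ : ∀ m n (A : ℕ → ℕ → ℝ) →
    altSum m (λ r → altSum n (A r))
      ≡ ∑[ i < m ] ∑[ j < n ] (sign (toℕ i) * (sign (toℕ j) * A (toℕ i) (toℕ j)))
  altSum²≡∑∑ m n A = trans (altSum≡∑ m _) (sum-cong-≗ {m} λ i →
    trans (cong (sign (toℕ i) *_) (altSum≡∑ n (A (toℕ i)))) (*-distribˡ-sum {n} _ _))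

  altSum-comm : ∀ m n (A : ℕ → ℕ → ℝ) →
    altSum m (λ r → altSum n (A r)) ≡ altSum n (λ s → altSum m (λ r → A r s))
  altSum-comm m n A = begin
    altSum m (λ r → altSum n (A r))
      ≡⟨ altSum²≡∑∑ m n A ⟩
    ∑[ i < m ] ∑[ j < n ] (sign (toℕ i) * (sign (toℕ j) * A (toℕ i) (toℕ j)))
      ≡⟨ ∑-comm {m} {n} _ ⟩
    ∑[ j < n ] ∑[ i < m ] (sign (toℕ i) * (sign (toℕ j) * A (toℕ i) (toℕ j)))
      ≡⟨ sum-cong-≗ {n} (λ j → sum-cong-≗ {m} (λ i → x*[y*z]≡y*[x*z] _ _ _)) ⟩
    ∑[ j < n ] ∑[ i < m ] (sign (toℕ j) * (sign (toℕ i) * A (toℕ i) (toℕ j)))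
      ≡⟨ sym (altSum²≡∑∑ n m (λ s r → A r s)) ⟩
    altSum n (λ s → altSum m (λ r → A r s)) ∎

  x+a*b*y+c*[d*y]≡x+c*d*y+a*[b*y] : ∀ x y a b c d →
    x + a * b * y + c * (d * y) ≡ x + c * d * y + a * (b * y)
  x+a*b*y+c*[d*y]≡x+c*d*y+a*[b*y] x y a b c d = begin
    x + a * b * y + c * (d * y)  ≡⟨ cong₂ (λ u v → x + u + v) (*-assoc a b y) (sym (*-assoc c d y)) ⟩
    x + a * (b * y) + c * d * y  ≡⟨ x+y+z≡x+z+y x _ _ ⟩
    x + c * d * y + a * (b * y)  ∎

proposition2p4 : (R : RealNumbers) → let open Reals R in
    (f : ℝ → ℝ → ℝ) → AlternatingInvariant f →
    (m n : ℕ) → Odd m → Odd n → (x y : ℝ) → 0ℝ < y →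
    altSum n (λ r → f (x + fromℕ r * fromℕ m * y) (fromℕ n * y))
      ≡ altSum m (λ r → f (x + fromℕ r * fromℕ n * y) (fromℕ m * y))
proposition2p4 R f invariant m n odd-m odd-n x y 0<y = begin
  altSum n (λ r → f (x + fromℕ r * fromℕ m * y) (fromℕ n * y))
    ≡⟨ altSum-cong n (λ r → sym (invariant _ _ (0<k*y odd-n) m odd-m)) ⟩
  altSum n (λ r → altSum m (λ s →
    f (x + fromℕ r * fromℕ m * y + fromℕ s * (fromℕ n * y)) (fromℕ m * (fromℕ n * y))))
    ≡⟨ altSum-cong n (λ r → altSum-cong m (λ s →
         cong₂ f (x+a*b*y+c*[d*y]≡x+c*d*y+a*[b*y] _ _ _ _ _ _) (x*[y*z]≡y*[x*z] _ _ _))) ⟩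
  altSum n (λ r → altSum m (λ s → F s r))
    ≡⟨ altSum-comm n m (λ r s → F s r) ⟩
  altSum m (λ s → altSum n (F s))
    ≡⟨ altSum-cong m (λ s → invariant _ _ (0<k*y odd-m) n odd-n) ⟩
  altSum m (λ r → f (x + fromℕ r * fromℕ n * y) (fromℕ m * y)) ∎
  where
  open Reals R
  open Properties R
  open ≡-Reasoning

  F : ℕ → ℕ → ℝ
  F s r = f (x + fromℕ s * fromℕ n * y + fromℕ r * (fromℕ m * y)) (fromℕ n * (fromℕ m * y))

  0<k*y : ∀ {k} → Odd k → 0ℝ < fromℕ k * y
  0<k*y odd-k = *-pos _ _ (0<fromℕ-odd odd-k) 0<y
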